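{- Let $\mathcal{G}=(H,\sigma,\alpha,h_0)$ be a rooted combinatorial map with underlying graph $G=(V,E)$, let $T$ be a spanning tree and let $S$ be a subgraph in the tree-interval $[T^-,T^+]$. Compare edges by the $(\mathcal{G},T)$-order. Then: (i) an edge $e$ is in $S\setminus T$ if and only if $e$ is the minimal edge of some cycle $C\subseteq S$; (ii) an edge $e$ is in $T\setminus S$ if and only if $e$ is the minimal edge of some cocycle $D\subseteq E\setminus S$.
   Context: A rooted combinatorial map is $\mathcal{G}=(H,\sigma,\alpha,h_0)$ where $H$ is a finite set of half-edges, $\sigma$ a permutation of $H$, $\alpha$ a fixed-point-free involution of $H$, the group generated by $\sigma,\alpha$ acts transitively on $H$, and $h_0\in H$ is the root. Its underlying graph $G=(V,E)$ has the cycles of $\sigma$ as vertices and the pairs $\{h,\alpha(h)\}$ as edges (loops, multiple edges allowed). Subgraphs are spanning and identified with edge sets. A cycle is the edge set of a simple closed path; a cocycle is a minimal set of edges whose deletion increases the number of connected components. For a spanning tree $T$, edges in $T$ are internal, others external; the motion function is $t(h)=\sigma\alpha(h)$ if the edge of $h$ is internal, $t(h)=\sigma(h)$ otherwise (a cyclic permutation of $H$); the $(\mathcal{G},T)$-order on $H$ is $h_0<t(h_0)<\dots<t^{|H|-1}(h_0)$, and edges are compared via their smaller half-edge. The fundamental cycle of an external edge $e$ is the set of $e'$ with $T-e'+e$ a spanning tree; the fundamental cocycle of an internal edge $e$ is the set of $e'$ with $T-e+e'$ a spanning tree. An edge is $(\mathcal{G},T)$-active if it is minimal for the $(\mathcal{G},T)$-order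 in its fundamental cycle (external) or fundamental cocycle (internal). The tree-interval $[T^-,T^+]$ is the set of subgraphs obtained from $T$ by removing some internal $(\mathcal{G},T)$-active edges and adding some external $(\mathcal{G},T)$-active edges. -}

module Defs where

open import Data.Nat using (ℕ; zero; suc; _≤_; _⊓_)
open import Data.Fin using (Fin; zero; suc; inject₁; fromℕ; _≟_)
open import Data.Fin.Permutation using (Permutation′; _⟨$⟩ʳ_; _⟨$⟩ˡ_)
open import Data.Bool using (Bool; true; false; _∧_; _∨_; not; if_then_else_)
open import Data.Product using (Σ; ∃; _×_; _,_)
open import Data.Sum using (_⊎_)
open import Relation.Nullary using (¬_)
open import Relation.Nullary.Decidable using (⌊_⌋)
open import Relation.Binary.PropositionalEquality using (_≡_; _≢_)

iter : ∀ {A : Set} → (A → A) → ℕ → A → A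
iter f zero    x = x
iter f (suc k) x = f (iter f k x)

record Map : Set where
  field
    n      : ℕ
    σ      : Permutation′ n
    α      : Fin n → Fin n
    α-inv  : ∀ h → α (α h) ≡ h
    α-fpf  : ∀ h → α h ≢ h
    root   : Fin n

-- One generator step of the group ⟨σ, α⟩ (σ, σ⁻¹, α = α⁻¹).
data Step (M : Map) : Fin (Map.n M) → Fin (Map.n M) → Set where
  stepσ  : ∀ h → Step M h (Map.σ M ⟨$⟩ʳ h)
  stepσ⁻ : ∀ h → Step M h (Map.σ M ⟨$⟩ˡ h)
  stepα  : ∀ h → Step M h (Map.α M h)

-- h' = g h for some g in the group generated by σ and α.
data Reach (M : Map) : Fin (Map.n M) → Fin (Map.n M) → Set where
  done : ∀ h → Reach M h h
  _∷_  : ∀ {h h' h''} → Step M h h' → Reach M h' h'' → Reach M h h''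

-- Transitivity of the action (part of the definition of a combinatorial map).
Transitive : Map → Set
Transitive M = ∀ h h' → Reach M h h'

module _ (M : Map) where
  open Map M

  H : Set
  H = Fin n

  σf : H → H
  σf h = σ ⟨$⟩ʳ h

  -- Edge sets (subgraphs) are α-closed Boolean predicates on half-edges:
  -- edge {h, α h} belongs to S iff S h ≡ true (≡ S (α h)).
  EdgeSet : Set
  EdgeSet = H → Bool

  IsEdgeSet : EdgeSet → Set
  IsEdgeSet S = ∀ h → S h ≡ S (α h)

  _⊆_ : EdgeSet → EdgeSet → Set
  A ⊆ B = ∀ h → A h ≡ true → B h ≡ true

  complement : EdgeSet → EdgeSet
  complement S h = not (S h)

  sameEdge : H → H → Bool
  sameEdge e x = ⌊ x ≟ e ⌋ ∨ ⌊ x ≟ α e ⌋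

  swap : EdgeSet → H → H → EdgeSet
  swap S e' e x = (S x ∧ not (sameEdge e' x)) ∨ sameEdge e x

  -- Two half-edges lie on the same vertex (same cycle of σ).
  SameVertex : H → H → Set
  SameVertex h h' = ∃ λ k → iter σf k h ≡ h'

  data Conn (S : EdgeSet) : H → H → Set where
    vert  : ∀ {h h'} → SameVertex h h' → Conn S h h'
    edge  : ∀ {h} → S h ≡ true → Conn S h (α h)
    csym  : ∀ {h h'} → Conn S h h' → Conn S h' h
    ctrans : ∀ {h h' h''} → Conn S h h' → Conn S h' h'' → Conn S h h''

  Connected : EdgeSet → Set
  Connected S = ∀ h h' → Conn S h h'

  -- A simple closed path of length m+1, given by half-edges hs i: the i-th
  -- edge {hs i, α (hs i)} goes from the vertex of hs i to the vertex of
  -- α (hs i), which is the vertex of hs (i+1) (cyclically).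
  record SimpleClosedPath (m : ℕ) (hs : Fin (suc m) → H) : Set where
    field
      consec   : ∀ (i : Fin m) → SameVertex (α (hs (inject₁ i))) (hs (suc i))
      close    : SameVertex (α (hs (fromℕ m))) (hs zero)
      vdistinct : ∀ i j → i ≢ j → ¬ SameVertex (hs i) (hs j)
      edistinct : ∀ i j → i ≢ j → (hs i ≢ hs j) × (hs i ≢ α (hs j))

  IsCycle : EdgeSet → Set
  IsCycle C = Σ ℕ λ m → Σ (Fin (suc m) → H) λ hs →
    SimpleClosedPath m hs ×
    (∀ h → C h ≡ true → ∃ λ i → (h ≡ hs i) ⊎ (h ≡ α (hs i))) ×
    (∀ i → C (hs i) ≡ true × C (α (hs i)) ≡ true)

  Disconnecting : EdgeSet → Set
  Disconnecting D = ¬ Connected (complement D)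

  -- A cocycle: a minimal edge set whose deletion increases the number of
  -- connected components (G being connected: whose deletion disconnects).
  IsCocycle : EdgeSet → Set
  IsCocycle D = IsEdgeSet D × Disconnecting D ×
    (∀ D' → IsEdgeSet D' → D' ⊆ D → Disconnecting D' → D ⊆ D')

  SpanningTree : EdgeSet → Set
  SpanningTree T = IsEdgeSet T × Connected T × (∀ C → IsCycle C → ¬ (C ⊆ T))

  motion : EdgeSet → H → H
  motion T h = if T h then σf (α h) else σf h

  -- position of h in the sequence root, t root, t² root, ... (first index,
  -- searched over n steps; t is a cyclic permutation so this is exact).
  findPos : (H → H) → ℕ → ℕ → H → H → ℕ
  findPos t zero    i c h = i
  findPos t (suc f) i c h = if ⌊ c ≟ h ⌋ then i else findPos t f (suc i) (t c) h

  pos : EdgeSet → H → ℕ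
  pos T h = findPos (motion T) n 0 root h

  ekey : EdgeSet → H → ℕ
  ekey T h = pos T h ⊓ pos T (α h)

  -- e' in the fundamental cycle of the external edge e.
  InFundCycle : EdgeSet → H → H → Set
  InFundCycle T e e' = SpanningTree (swap T e' e)

  -- e' in the fundamental cocycle of the internal edge e.
  InFundCocycle : EdgeSet → H → H → Set
  InFundCocycle T e e' = SpanningTree (swap T e e')

  Active : EdgeSet → H → Set
  Active T e =
    (T e ≡ false → ∀ e' → InFundCycle T e e' → ekey T e ≤ ekey T e') ×
    (T e ≡ true → ∀ e' → InFundCocycle T e e' → ekey T e ≤ ekey T e')

  -- S ∈ [T⁻, T⁺]: S differs from T only on (G,T)-active edges
  -- (removed ones internal active, added ones external active).
  InTreeInterval : EdgeSet → EdgeSet → Set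
  InTreeInterval T S = IsEdgeSet S × (∀ h → S h ≢ T h → Active T h)

-- Deleting an internal edge f from T splits the half-edges into two sides; the edges joining them form
-- the fundamental cocycle of f, exchanging f for any of them yields a spanning tree, and no closed path
-- crosses this cut exactly once. Since the tour visits every half-edge, distinct edges have distinct
-- keys, so an internal edge removed from T and an external edge added to it, exchangeable with each
-- other, cannot both be active: each would have the smaller key. Hence the fundamental cycle of an
-- added edge e lies in S, and the cut of a removed edge e avoids S; both are minimal at e by activity.
-- Conversely, a cycle in S through an internal e crosses the cut of e again at an added edge, and a
-- cocycle outside S through an external e meets the fundamental cycle of e again at a removed edge;
-- either way activity gives that edge a smaller key than e, contradicting minimality.
module Submission where

open import Defs
open import Data.Bool using (Bool; true; false; _∧_; _∨_; not; _xor_) renaming (_≟_ to _≟ᵇ_)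
open import Data.Bool.Properties
  using (not-injective; ¬-not; xor-comm; ∧-conicalˡ; ∧-zeroʳ; ∧-identityʳ; ∨-zeroʳ)
open import Data.Empty using (⊥; ⊥-elim)
open import Data.Fin using (Fin; zero; suc; toℕ; fromℕ; fromℕ<; inject₁; _≟_)
open import Data.Fin.Properties
  using (toℕ<n; toℕ-injective; toℕ-inject₁; toℕ-fromℕ; toℕ-fromℕ<; inject₁-injective; fromℕ≢inject₁;
         any?; pigeonhole)
open import Data.Fin.Permutation using (_⟨$⟩ˡ_; inverseˡ)
open import Data.Nat using (ℕ; zero; suc; _+_; _*_; _∸_; _≤_; _<_; s≤s; s≤s⁻¹; _⊓_; _%_; _/_)
open import Data.Nat.DivMod using (m≡m%n+[m/n]*n; m%n<n)
open import Data.Nat.Properties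
  using (<-asym; ≤-refl; ≤-trans; ≤-reflexive; ≤-antisym; <⇒≤; <⇒≢; >⇒≢; n<1+n; n≤1+n; m≤m+n; m≤m*n;
         m∸n≤m; m<n⇒0<n∸m; m∸n+n≡m; m+[n∸m]≡n; +-suc; +-identityʳ; +-monoʳ-≤; m≤n⇒m<n∨m≡n; ⊓-comm; ⊓-sel)
open import Data.Product using (Σ; ∃; _×_; _,_; proj₁; proj₂)
open import Data.Sum using (_⊎_; inj₁; inj₂; [_,_]′)
open import Data.Unit using (⊤; tt)
open import Function.Base using (id; _∘_; _$_; case_of_)
open import Function.Bundles using (_⇔_; mk⇔)
open import Relation.Nullary using (¬_; Dec; yes; no; does)
open import Relation.Nullary.Decidable
  using (isYes≗does; dec-true; dec-false; does-⇔; decidable-stable; ¬?; _⊎-dec_; _×-dec_)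
open import Relation.Binary.PropositionalEquality
open ≡-Reasoning

iter-+ : ∀ {A : Set} (f : A → A) m n x → iter f (m + n) x ≡ iter f m (iter f n x)
iter-+ f zero    n x = refl
iter-+ f (suc m) n x = cong f (iter-+ f m n x)

iter-comm : ∀ {A : Set} (f : A → A) k x → iter f k (f x) ≡ f (iter f k x)
iter-comm f zero    x = refl
iter-comm f (suc k) x = cong f (iter-comm f k x)

iter-injective : ∀ {A : Set} (f : A → A) → (∀ {x y} → f x ≡ f y → x ≡ y) →
  ∀ k {x y} → iter f k x ≡ iter f k y → x ≡ y
iter-injective f f-inj zero    eq = eq
iter-injective f f-inj (suc k) eq = iter-injective f f-inj k (f-inj eq)

iter-*-fixed : ∀ {A : Set} (f : A → A) p {x} → iter f p x ≡ x → ∀ q → iter f (q * p) x ≡ x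
iter-*-fixed f p     fixed zero    = refl
iter-*-fixed f p {x} fixed (suc q) = begin
  iter f (p + q * p) x        ≡⟨ iter-+ f p (q * p) x ⟩
  iter f p (iter f (q * p) x) ≡⟨ cong (iter f p) (iter-*-fixed f p fixed q) ⟩
  iter f p x                  ≡⟨ fixed ⟩
  x                           ∎

true-witness : ∀ {A : Set} (a? : Dec A) → does a? ≡ true → A
true-witness (yes a) _ = a

∨-true : ∀ {a b} → a ∨ b ≡ true → a ≡ true ⊎ b ≡ true
∨-true {true}  _  = inj₁ refl
∨-true {false} eq = inj₂ eq

xor-≢ : ∀ {a b} → a xor b ≡ true → a ≢ b
xor-≢ {true}  {false} _ ()
xor-≢ {false} {true}  _ ()

≢-xor : ∀ {a b} → a ≢ b → a xor b ≡ true
≢-xor {true}  {true}  a≢b = ⊥-elim (a≢b refl)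
≢-xor {true}  {false} _   = refl
≢-xor {false} {true}  _   = refl
≢-xor {false} {false} a≢b = ⊥-elim (a≢b refl)

xor-≡ : ∀ {a b} → a xor b ≡ false → a ≡ b
xor-≡ {true}  {true}  _ = refl
xor-≡ {false} {false} _ = refl

module Orbits {n : ℕ} (f : Fin n → Fin n) (f-injective : ∀ {x y} → f x ≡ f y → x ≡ y) where

  _↝_ : Fin n → Fin n → Set
  x ↝ y = ∃ λ k → iter f k x ≡ y

  period : ∀ x → ∃ λ p → 0 < p × p ≤ n × iter f p x ≡ x
  period x with i , j , i<j , same ← pigeonhole (n<1+n n) (λ (i : Fin (suc n)) → iter f (toℕ i) x) =
    toℕ j ∸ toℕ i , m<n⇒0<n∸m i<j , ≤-trans (m∸n≤m (toℕ j) (toℕ i)) (s≤s⁻¹ (toℕ<n j)) ,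
    iter-injective f f-injective (toℕ i) (begin
      iter f (toℕ i) (iter f (toℕ j ∸ toℕ i) x) ≡⟨ iter-+ f (toℕ i) (toℕ j ∸ toℕ i) x ⟨
      iter f (toℕ i + (toℕ j ∸ toℕ i)) x        ≡⟨ cong (λ k → iter f k x) (m+[n∸m]≡n (<⇒≤ i<j)) ⟩
      iter f (toℕ j) x                          ≡⟨ same ⟨
      iter f (toℕ i) x                          ∎)

  ↝-refl : ∀ {x} → x ↝ x
  ↝-refl = 0 , refl

  ↝-trans : ∀ {x y z} → x ↝ y → y ↝ z → x ↝ z
  ↝-trans {x} (k , refl) (l , refl) = l + k , iter-+ f l k x

  ↝-sym : ∀ {x y} → x ↝ y → y ↝ x
  ↝-sym {x} (k , refl) with suc p , _ , _ , fixed ← period x = k * suc p ∸ k , (begin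
    iter f (k * suc p ∸ k) (iter f k x) ≡⟨ iter-+ f (k * suc p ∸ k) k x ⟨
    iter f (k * suc p ∸ k + k) x        ≡⟨ cong (λ j → iter f j x) (m∸n+n≡m (m≤m*n k (suc p))) ⟩
    iter f (k * suc p) x                ≡⟨ iter-*-fixed f (suc p) fixed k ⟩
    x                                   ∎)

  ↝-bounded : ∀ {x y} → x ↝ y → ∃ λ k → k < n × iter f k x ≡ y
  ↝-bounded {x} (k , refl) with suc p , _ , p≤n , fixed ← period x =
    k % suc p , ≤-trans (m%n<n k (suc p)) p≤n , (begin
      iter f (k % suc p) x
        ≡⟨ cong (iter f (k % suc p)) (iter-*-fixed f (suc p) fixed (k / suc p)) ⟨
      iter f (k % suc p) (iter f (k / suc p * suc p) x)
        ≡⟨ iter-+ f (k % suc p) (k / suc p * suc p) x ⟨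
      iter f (k % suc p + k / suc p * suc p) x
        ≡⟨ cong (λ j → iter f j x) (m≡m%n+[m/n]*n k (suc p)) ⟨
      iter f k x
        ∎)

  -- The orbit of x steps into P and eventually returns to x ∉ P, so it leaves P, which it can only do at y.
  ↝-exit : (P : Fin n → Set) → ∀ {x y} → (∀ z → P z → z ≢ y → P (f z)) → P (f x) → ¬ P x → x ↝ y
  ↝-exit P {x} {y} stays Pfx ¬Px with suc p , _ , _ , fixed ← period x =
    [ id , ⊥-elim ∘ ¬Px ∘ subst P fixed ]′ (run p)
    where
    run : ∀ j → x ↝ y ⊎ P (iter f (suc j) x)
    run zero = inj₂ Pfx
    run (suc j) with run j
    ... | inj₁ x↝y = inj₁ x↝y
    ... | inj₂ Pj with iter f (suc j) x ≟ y
    ...   | yes eq = inj₁ (suc j , eq)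
    ...   | no  ne = inj₂ (stays _ Pj ne)

  _↝?_ : ∀ x y → Dec (x ↝ y)
  x ↝? y with any? (λ (i : Fin n) → iter f (toℕ i) x ≟ y)
  ... | yes (i , eq) = yes (toℕ i , eq)
  ... | no none      = no λ x↝y → let k , k<n , eq = ↝-bounded x↝y in
                                  none (fromℕ< k<n , trans (cong (λ j → iter f j x) (toℕ-fromℕ< k<n)) eq)

module MapProperties (M : Map) where
  open Map M

  σ-injective : ∀ {x y} → σf M x ≡ σf M y → x ≡ y
  σ-injective {x} {y} eq = begin
    x                   ≡⟨ inverseˡ σ ⟨
    σ ⟨$⟩ˡ (σf M x)     ≡⟨ cong (σ ⟨$⟩ˡ_) eq ⟩
    σ ⟨$⟩ˡ (σf M y)     ≡⟨ inverseˡ σ ⟩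
    y                   ∎

  α-injective : ∀ {x y} → α x ≡ α y → x ≡ y
  α-injective {x} {y} eq = trans (sym (α-inv x)) (trans (cong α eq) (α-inv y))

  open Orbits (σf M) σ-injective public
    using () renaming (↝-refl to ~-refl; ↝-sym to ~-sym; ↝-trans to ~-trans; _↝?_ to _~?_)

  _~_ : H M → H M → Set
  _~_ = SameVertex M

  ≡⇒~ : ∀ {x y} → x ≡ y → x ~ y
  ≡⇒~ refl = ~-refl

  ~-step : ∀ x → x ~ σf M x
  ~-step x = 1 , refl

  ~-invariant : ∀ {B : Set} (f : H M → B) → (∀ x → f (σf M x) ≡ f x) → ∀ {x y} → x ~ y → f x ≡ f y
  ~-invariant f f-σ (zero  , refl) = refl
  ~-invariant f f-σ (suc k , refl) = trans (~-invariant f f-σ (k , refl)) (sym (f-σ _))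

  OnEdge : H M → H M → Set
  OnEdge e x = (x ≡ e) ⊎ (x ≡ α e)

  onEdge? : ∀ e x → Dec (OnEdge e x)
  onEdge? e x = (x ≟ e) ⊎-dec (x ≟ α e)

  OnEdge-sym : ∀ {e x} → OnEdge e x → OnEdge x e
  OnEdge-sym (inj₁ refl) = inj₁ refl
  OnEdge-sym {e} (inj₂ refl) = inj₂ (sym (α-inv e))

  OnEdge-trans : ∀ {e x y} → OnEdge e x → OnEdge x y → OnEdge e y
  OnEdge-trans (inj₁ refl) x∼y = x∼y
  OnEdge-trans (inj₂ refl) (inj₁ refl) = inj₂ refl
  OnEdge-trans {e} (inj₂ refl) (inj₂ refl) = inj₁ (α-inv e)

  OnEdge-α : ∀ {e x} → OnEdge e (α x) → OnEdge e x
  OnEdge-α {e} {x} e∼αx = OnEdge-trans e∼αx (inj₂ (sym (α-inv x)))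

  sameEdge-does : ∀ e x → sameEdge M e x ≡ does (onEdge? e x)
  sameEdge-does e x = cong₂ _∨_ (isYes≗does (x ≟ e)) (isYes≗does (x ≟ α e))

  sameEdge-sound : ∀ {e x} → sameEdge M e x ≡ true → OnEdge e x
  sameEdge-sound {e} {x} eq = true-witness (onEdge? e x) (trans (sym (sameEdge-does e x)) eq)

  sameEdge-complete : ∀ {e x} → OnEdge e x → sameEdge M e x ≡ true
  sameEdge-complete {e} {x} e∼x = trans (sameEdge-does e x) (dec-true (onEdge? e x) e∼x)

  sameEdge-α : ∀ e x → sameEdge M e (α x) ≡ sameEdge M e x
  sameEdge-α e x = begin
    sameEdge M e (α x)       ≡⟨ sameEdge-does e (α x) ⟩
    does (onEdge? e (α x))   ≡⟨ does-⇔ (mk⇔ OnEdge-α (λ e∼x → OnEdge-trans e∼x (inj₂ refl)))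
                                       (onEdge? e (α x)) (onEdge? e x) ⟩
    does (onEdge? e x)       ≡⟨ sameEdge-does e x ⟨
    sameEdge M e x           ∎

  edgeSet-α : ∀ {S} → IsEdgeSet M S → ∀ {x} → S x ≡ true → S (α x) ≡ true
  edgeSet-α S-edges {x} Sx = trans (sym (S-edges x)) Sx

  edgeSet-onEdge : ∀ {S} → IsEdgeSet M S → ∀ {e x} → OnEdge e x → S x ≡ S e
  edgeSet-onEdge S-edges (inj₁ refl) = refl
  edgeSet-onEdge S-edges {e} (inj₂ refl) = sym (S-edges e)

  _∖_ : EdgeSet M → H M → EdgeSet M
  (S ∖ e) x = S x ∧ not (sameEdge M e x)

  ∖-⊆ : ∀ S {e x} → (S ∖ e) x ≡ true → S x ≡ true
  ∖-⊆ S {e} {x} = ∧-conicalˡ (S x) _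

  ∖-off-edge : ∀ S {e x} → ¬ OnEdge e x → (S ∖ e) x ≡ S x
  ∖-off-edge S {e} {x} x∉e =
    trans (cong (λ b → S x ∧ not b) (trans (sameEdge-does e x) (dec-false (onEdge? e x) x∉e)))
          (∧-identityʳ (S x))

  ∖-intro : ∀ S {e x} → S x ≡ true → ¬ OnEdge e x → (S ∖ e) x ≡ true
  ∖-intro S Sx x∉e = trans (∖-off-edge S x∉e) Sx

  ∖-self : ∀ {S} e → (S ∖ e) e ≡ false
  ∖-self {S} e = trans (cong (λ b → S e ∧ not b) (sameEdge-complete {e} (inj₁ refl))) (∧-zeroʳ (S e))

  ∖-∌ : ∀ S e → ¬ ((S ∖ e) e ≡ true)
  ∖-∌ S e e∈ with () ← trans (sym (∖-self {S} e)) e∈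

  ∖-isEdgeSet : ∀ {S} → IsEdgeSet M S → ∀ e → IsEdgeSet M (S ∖ e)
  ∖-isEdgeSet S-edges e x = cong₂ (λ a b → a ∧ not b) (S-edges x) (sym (sameEdge-α e x))

  swap-old : ∀ S {e′ e x} → (S ∖ e′) x ≡ true → swap M S e′ e x ≡ true
  swap-old S Sx = cong (_∨ _) Sx

  swap-new : ∀ S {e′ e x} → OnEdge e x → swap M S e′ e x ≡ true
  swap-new S {e′} {e} {x} e∼x = trans (cong ((S ∖ e′) x ∨_) (sameEdge-complete e∼x)) (∨-zeroʳ _)

  swap-elim : ∀ S {e′ e x} → swap M S e′ e x ≡ true → (S ∖ e′) x ≡ true ⊎ OnEdge e x
  swap-elim S x∈ with ∨-true x∈
  ... | inj₁ old = inj₁ old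
  ... | inj₂ new = inj₂ (sameEdge-sound new)

  swap-isEdgeSet : ∀ {S} → IsEdgeSet M S → ∀ e′ e → IsEdgeSet M (swap M S e′ e)
  swap-isEdgeSet S-edges e′ e x = cong₂ _∨_ (∖-isEdgeSet S-edges e′ x) (sym (sameEdge-α e x))

  findPos-correct : ∀ (g : H M → H M) m i c h → (∃ λ k → k < m × iter g k c ≡ h) →
    ∃ λ k → findPos M g m i c h ≡ i + k × iter g k c ≡ h
  findPos-correct g (suc m) i c h (k , k<m , eq) with c ≟ h
  ... | yes c≡h = 0 , sym (+-identityʳ i) , c≡h
  findPos-correct g (suc m) i c h (zero  , _   , eq) | no c≢h = ⊥-elim (c≢h eq)
  findPos-correct g (suc m) i c h (suc k , k<m , eq) | no c≢h
    with k′ , found , eq′ ← findPos-correct g m (suc i) (g c) h (k , s≤s⁻¹ k<m , trans (iter-comm g k c) eq) =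
    suc k′ , trans found (sym (+-suc i k′)) , trans (sym (iter-comm g k′ c)) eq′

  Conn-replace : ∀ {S S′} → (∀ h → S h ≡ true → Conn M S′ h (α h)) →
    ∀ {x y} → Conn M S x y → Conn M S′ x y
  Conn-replace f (vert p)     = vert p
  Conn-replace f (edge s)     = f _ s
  Conn-replace f (csym c)     = csym (Conn-replace f c)
  Conn-replace f (ctrans c d) = ctrans (Conn-replace f c) (Conn-replace f d)

  Conn-mono : ∀ {S S′} → _⊆_ M S S′ → ∀ {x y} → Conn M S x y → Conn M S′ x y
  Conn-mono S⊆S′ = Conn-replace (λ h s → edge (S⊆S′ h s))

  Conn-∖-complement : ∀ {D e} → Conn M (complement M D) e (α e) → ∀ {x y} →
    Conn M (complement M (D ∖ e)) x y → Conn M (complement M D) x y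
  Conn-∖-complement {D} {e} e-linked = Conn-replace replace
    where
    replace : ∀ h → complement M (D ∖ e) h ≡ true → Conn M (complement M D) h (α h)
    replace h h∉D∖e with onEdge? e h
    ... | yes (inj₁ refl) = e-linked
    ... | yes (inj₂ refl) = subst (Conn M (complement M D) (α e)) (sym (α-inv e)) (csym e-linked)
    ... | no h∉e          = edge (trans (cong not (sym (∖-off-edge D h∉e))) h∉D∖e)

  Conn-invariant : ∀ {B : Set} {S} (f : H M → B) → (∀ x → f (σf M x) ≡ f x) →
    (∀ h → S h ≡ true → f (α h) ≡ f h) → ∀ {x y} → Conn M S x y → f x ≡ f y
  Conn-invariant f f-σ f-α (vert p)     = ~-invariant f f-σ p
  Conn-invariant f f-σ f-α (edge s)     = sym (f-α _ s)
  Conn-invariant f f-σ f-α (csym c)     = sym (Conn-invariant f f-σ f-α c)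
  Conn-invariant f f-σ f-α (ctrans c d) = trans (Conn-invariant f f-σ f-α c) (Conn-invariant f f-σ f-α d)

module Walks (M : Map) (S : EdgeSet M) where
  open Map M
  open MapProperties M

  data Walk : H M → H M → Set where
    stay : ∀ {x y} → x ~ y → Walk x y
    hop  : ∀ {x g y} → x ~ g → S g ≡ true → Walk (α g) y → Walk x y

  _◅~_ : ∀ {x′ x y} → x′ ~ x → Walk x y → Walk x′ y
  p ◅~ stay q     = stay (~-trans p q)
  p ◅~ hop q s w  = hop (~-trans p q) s w

  _++_ : ∀ {x y z} → Walk x y → Walk y z → Walk x z
  stay p    ++ w′ = p ◅~ w′
  hop p s w ++ w′ = hop p s (w ++ w′)

  reverse : IsEdgeSet M S → ∀ {x y} → Walk x y → Walk y x
  reverse S-edges (stay p) = stay (~-sym p)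
  reverse S-edges (hop {x} {g} p s w) = reverse S-edges w ++ hop ~-refl (edgeSet-α S-edges s) back
    where
    back : Walk (α (α g)) x
    back = subst (λ z → Walk z x) (sym (α-inv g)) (stay (~-sym p))

  fromConn : IsEdgeSet M S → ∀ {x y} → Conn M S x y → Walk x y
  fromConn S-edges (vert p)     = stay p
  fromConn S-edges (edge s)     = hop ~-refl s (stay ~-refl)
  fromConn S-edges (csym c)     = reverse S-edges (fromConn S-edges c)
  fromConn S-edges (ctrans c d) = fromConn S-edges c ++ fromConn S-edges d

  Walk-closed : (P : H M → Set) → (∀ {x y} → x ~ y → P x → P y) → (∀ {g} → S g ≡ true → P g → P (α g)) →
    ∀ {x y} → Walk x y → P x → P y
  Walk-closed P P-~ P-α (stay p)    = P-~ p
  Walk-closed P P-~ P-α (hop p s w) = Walk-closed P P-~ P-α w ∘ P-α s ∘ P-~ p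

  Visits : ∀ {x y} → H M → Walk x y → Set
  Visits v (stay {x} _)  = v ~ x
  Visits v (hop {x} _ _ w) = v ~ x ⊎ Visits v w

  visits? : ∀ {x y} v (w : Walk x y) → Dec (Visits v w)
  visits? v (stay {x} _)    = v ~? x
  visits? v (hop {x} _ _ w) = (v ~? x) ⊎-dec visits? v w

  Visits-~ : ∀ {x y v v′} → v′ ~ v → (w : Walk x y) → Visits v w → Visits v′ w
  Visits-~ q (stay _)    i        = ~-trans q i
  Visits-~ q (hop _ _ w) (inj₁ i) = inj₁ (~-trans q i)
  Visits-~ q (hop _ _ w) (inj₂ i) = inj₂ (Visits-~ q w i)

  Simple : ∀ {x y} → Walk x y → Set
  Simple (stay _)        = ⊤
  Simple (hop {x} _ _ w) = ¬ Visits x w × Simple w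

  SimpleWalk : H M → H M → Set
  SimpleWalk x y = Σ (Walk x y) Simple

  shortcut : ∀ {x z y} (w : Walk z y) → Simple w → Visits x w → SimpleWalk x y
  shortcut (stay q)    _          i        = stay (~-trans i q) , tt
  shortcut (hop q s w) (x∉w , sw) (inj₁ i) = hop (~-trans i q) s w , (λ j → x∉w (Visits-~ (~-sym i) w j)) , sw
  shortcut (hop q s w) (_ , sw)   (inj₂ i) = shortcut w sw i

  simplify : ∀ {x y} → Walk x y → SimpleWalk x y
  simplify (stay p) = stay p , tt
  simplify (hop {x} p s w) with simplify w
  ... | w′ , sw′ with visits? x w′
  ...   | yes i  = shortcut w′ sw′ i
  ...   | no x∉w = hop p s w′ , x∉w , sw′

  length : ∀ {x y} → Walk x y → ℕ
  length (stay _)    = zero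
  length (hop _ _ w) = suc (length w)

  edgeAt : ∀ {x y} (w : Walk x y) → Fin (length w) → H M
  edgeAt (hop {g = g} _ _ w) zero    = g
  edgeAt (hop _ _ w)         (suc i) = edgeAt w i

  vertexAt : ∀ {x y} (w : Walk x y) → Fin (suc (length w)) → H M
  vertexAt (stay {x} _)    zero    = x
  vertexAt (hop {x} _ _ w) zero    = x
  vertexAt (hop _ _ w)     (suc i) = vertexAt w i

  vertexAt-zero : ∀ {x y} (w : Walk x y) → vertexAt w zero ≡ x
  vertexAt-zero (stay _)    = refl
  vertexAt-zero (hop _ _ _) = refl

  vertexAt-last : ∀ {x y} (w : Walk x y) → vertexAt w (fromℕ (length w)) ~ y
  vertexAt-last (stay p)    = p
  vertexAt-last (hop _ _ w) = vertexAt-last w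

  edgeAt-∈ : ∀ {x y} (w : Walk x y) i → S (edgeAt w i) ≡ true
  edgeAt-∈ (hop _ s w) zero    = s
  edgeAt-∈ (hop _ _ w) (suc i) = edgeAt-∈ w i

  edgeAt-tail : ∀ {x y} (w : Walk x y) i → edgeAt w i ~ vertexAt w (inject₁ i)
  edgeAt-tail (hop p _ w) zero    = ~-sym p
  edgeAt-tail (hop _ _ w) (suc i) = edgeAt-tail w i

  edgeAt-head : ∀ {x y} (w : Walk x y) i → α (edgeAt w i) ≡ vertexAt w (suc i)
  edgeAt-head (hop _ _ w) zero    = sym (vertexAt-zero w)
  edgeAt-head (hop _ _ w) (suc i) = edgeAt-head w i

  vertexAt-visits : ∀ {x y v} (w : Walk x y) j → v ~ vertexAt w j → Visits v w
  vertexAt-visits (stay _)    zero    q = q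
  vertexAt-visits (hop _ _ w) zero    q = inj₁ q
  vertexAt-visits (hop _ _ w) (suc j) q = inj₂ (vertexAt-visits w j q)

  vertexAt-injective : ∀ {x y} (w : Walk x y) → Simple w → ∀ i j → vertexAt w i ~ vertexAt w j → i ≡ j
  vertexAt-injective (stay _)    _          zero    zero    q = refl
  vertexAt-injective (hop _ _ w) _          zero    zero    q = refl
  vertexAt-injective (hop _ _ w) (x∉w , sw) zero    (suc j) q = ⊥-elim (x∉w (vertexAt-visits w j q))
  vertexAt-injective (hop _ _ w) (x∉w , sw) (suc i) zero    q = ⊥-elim (x∉w (vertexAt-visits w i (~-sym q)))
  vertexAt-injective (hop _ _ w) (x∉w , sw) (suc i) (suc j) q = cong suc (vertexAt-injective w sw i j q)

cyclicPred : ∀ {m} → Fin (suc m) → Fin (suc m)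
cyclicPred {m} zero = fromℕ m
cyclicPred (suc i)  = inject₁ i

cyclicPred-injective : ∀ {m} (i j : Fin (suc m)) → cyclicPred i ≡ cyclicPred j → i ≡ j
cyclicPred-injective zero    zero    eq = refl
cyclicPred-injective zero    (suc j) eq = ⊥-elim (fromℕ≢inject₁ eq)
cyclicPred-injective (suc i) zero    eq = ⊥-elim (fromℕ≢inject₁ (sym eq))
cyclicPred-injective (suc i) (suc j) eq = cong suc (inject₁-injective eq)

clamp : (m k : ℕ) → Fin (suc m)
clamp m       zero    = zero
clamp zero    (suc k) = zero
clamp (suc m) (suc k) = suc (clamp m k)

toℕ-clamp : ∀ m k → k ≤ m → toℕ (clamp m k) ≡ k
toℕ-clamp m       zero    _         = refl
toℕ-clamp (suc m) (suc k) (s≤s k≤m) = cong suc (toℕ-clamp m k k≤m)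

clamp-toℕ : ∀ m (i : Fin (suc m)) → clamp m (toℕ i) ≡ i
clamp-toℕ m       zero    = refl
clamp-toℕ (suc m) (suc i) = cong suc (clamp-toℕ m i)

module ClosedPaths (M : Map) where
  open Map M
  open MapProperties M

  record CycleThrough (S : EdgeSet M) (h : H M) : Set where
    field
      len    : ℕ
      path   : Fin (suc len) → H M
      simple : SimpleClosedPath M len path
      starts : path zero ≡ h
      rest-∈ : ∀ i → S (path (suc i)) ≡ true

  module CloseWalk {S : EdgeSet M} (S-edges : IsEdgeSet M S) {h : H M} (h∉S : S h ≡ false)
                   (w : Walks.Walk M S (α h) h) (simple : Walks.Simple M S w) where
    open Walks M S

    -- path j leaves the walk at vertex cyclicPred j and enters it at vertex j.
    path : Fin (suc (length w)) → H M
    path zero    = h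
    path (suc i) = edgeAt w i

    path-head : ∀ j → α (path j) ~ vertexAt w j
    path-head zero    = ≡⇒~ (sym (vertexAt-zero w))
    path-head (suc i) = ≡⇒~ (edgeAt-head w i)

    path-tail : ∀ j → path j ~ vertexAt w (cyclicPred j)
    path-tail zero    = ~-sym (vertexAt-last w)
    path-tail (suc i) = edgeAt-tail w i

    vertices-distinct : ∀ i j → i ≢ j → ¬ (path i ~ path j)
    vertices-distinct i j i≢j p = i≢j (cyclicPred-injective i j
      (vertexAt-injective w simple _ _ (~-trans (~-sym (path-tail i)) (~-trans p (path-tail j)))))

    α-path : ∀ i j → path i ≡ α (path j) → cyclicPred i ≡ j
    α-path i j eq = vertexAt-injective w simple (cyclicPred i) j
      (~-trans (~-sym (path-tail i)) (subst (_~ vertexAt w j) (sym eq) (path-head j)))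

    h≢α-edgeAt : ∀ i → h ≢ α (edgeAt w i)
    h≢α-edgeAt i eq with () ← trans (sym h∉S) (trans (cong S eq) (edgeSet-α S-edges (edgeAt-∈ w i)))

    not-reversed : ∀ i j → i ≢ j → path i ≢ α (path j)
    not-reversed zero    zero    i≢j eq = i≢j refl
    not-reversed zero    (suc b) i≢j eq = h≢α-edgeAt b eq
    not-reversed (suc a) zero    i≢j eq = h≢α-edgeAt a (trans (sym (α-inv h)) (cong α (sym eq)))
    not-reversed (suc a) (suc b) i≢j eq = <-asym (≤-reflexive (sym a≡1+b)) (≤-reflexive (sym b≡1+a))
      where
      a≡1+b : toℕ a ≡ suc (toℕ b)
      a≡1+b = trans (sym (toℕ-inject₁ a)) (cong toℕ (α-path (suc a) (suc b) eq))
      b≡1+a : toℕ b ≡ suc (toℕ a)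
      b≡1+a = trans (sym (toℕ-inject₁ b))
        (cong toℕ (α-path (suc b) (suc a) (trans (sym (α-inv _)) (cong α (sym eq)))))

    closedPath : SimpleClosedPath M (length w) path
    closedPath = record
      { consec    = λ i → ~-trans (path-head (inject₁ i)) (~-sym (path-tail (suc i)))
      ; close     = ~-trans (path-head (fromℕ (length w))) (~-sym (path-tail zero))
      ; vdistinct = vertices-distinct
      ; edistinct = λ i j i≢j → (λ eq → vertices-distinct i j i≢j (≡⇒~ eq)) , not-reversed i j i≢j
      }

  cycleThrough : ∀ {S} → IsEdgeSet M S → ∀ {h} → S h ≡ false → Conn M S (α h) h → CycleThrough S h
  cycleThrough {S} S-edges h∉S c = record
    { len = length w ; path = path ; simple = closedPath ; starts = refl ; rest-∈ = edgeAt-∈ w }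
    where
    open Walks M S
    w : Walk _ _
    w = proj₁ (simplify (fromConn S-edges c))
    open CloseWalk S-edges h∉S w (proj₂ (simplify (fromConn S-edges c)))

  edgesOf : ∀ m → (Fin (suc m) → H M) → EdgeSet M
  edgesOf m hs x = does (any? (λ i → onEdge? (hs i) x))

  edgesOf-sound : ∀ {m hs} x → edgesOf m hs x ≡ true → ∃ λ i → OnEdge (hs i) x
  edgesOf-sound {m} {hs} x = true-witness (any? (λ i → onEdge? (hs i) x))

  edgesOf-complete : ∀ {m hs x} i → OnEdge (hs i) x → edgesOf m hs x ≡ true
  edgesOf-complete {m} {hs} {x} i hs∼x = dec-true (any? (λ i → onEdge? (hs i) x)) (i , hs∼x)

  edgesOf-⊆ : ∀ {m hs S} → IsEdgeSet M S → (∀ i → S (hs i) ≡ true) → _⊆_ M (edgesOf m hs) S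
  edgesOf-⊆ S-edges hs-∈ x x∈ with i , hs∼x ← edgesOf-sound x x∈ =
    trans (edgeSet-onEdge S-edges hs∼x) (hs-∈ i)

  edgesOf-isCycle : ∀ {m hs} → SimpleClosedPath M m hs → IsCycle M (edgesOf m hs)
  edgesOf-isCycle {m} {hs} scp = m , hs , scp , edgesOf-sound ,
    λ i → edgesOf-complete {hs = hs} i (inj₁ refl) , edgesOf-complete {hs = hs} i (inj₂ refl)

  module _ {m : ℕ} {hs : Fin (suc m) → H M} (scp : SimpleClosedPath M m hs) where
    open SimpleClosedPath scp

    closedPath-edge-unique : ∀ {x} i j → OnEdge x (hs i) → OnEdge x (hs j) → i ≡ j
    closedPath-edge-unique {x} i j x∼i x∼j with i ≟ j
    ... | yes i≡j = i≡j
    ... | no i≢j with OnEdge-trans (OnEdge-sym x∼j) x∼i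
    ...   | inj₁ eq = ⊥-elim (proj₁ (edistinct i j i≢j) eq)
    ...   | inj₂ eq = ⊥-elim (proj₂ (edistinct i j i≢j) eq)

    private
      at : ℕ → H M
      at k = hs (clamp m k)

      at-consec : ∀ c → c < m → α (at c) ~ at (suc c)
      at-consec c c<m = subst₂ (λ a b → α (hs a) ~ hs b) inject₁-i≡c suc-i≡1+c (consec i)
        where
        i = fromℕ< c<m
        inject₁-i≡c : inject₁ i ≡ clamp m c
        inject₁-i≡c = toℕ-injective (trans (toℕ-inject₁ i)
          (trans (toℕ-fromℕ< c<m) (sym (toℕ-clamp m c (<⇒≤ c<m)))))
        suc-i≡1+c : suc i ≡ clamp m (suc c)
        suc-i≡1+c = toℕ-injective (trans (cong suc (toℕ-fromℕ< c<m)) (sym (toℕ-clamp m (suc c) c<m)))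

      at-close : α (at m) ~ at 0
      at-close = subst (λ a → α (hs a) ~ hs zero)
        (toℕ-injective (trans (toℕ-fromℕ m) (sym (toℕ-clamp m m ≤-refl)))) close

      segment : ∀ S′ a d → a + d ≤ m → (∀ c → a ≤ c → c < a + d → S′ (at c) ≡ true) →
        Conn M S′ (at a) (at (a + d))
      segment S′ a zero    _  _   = subst (λ k → Conn M S′ (at a) (at k)) (sym (+-identityʳ a)) (vert ~-refl)
      segment S′ a (suc d) le ∈S′ = subst (λ k → Conn M S′ (at a) (at k)) (sym (+-suc a d))
        (ctrans (segment S′ a d a+d≤m (λ c a≤c c<a+d → ∈S′ c a≤c (≤-trans c<a+d a+d≤a+1+d)))
          (ctrans (edge (∈S′ (a + d) (m≤m+n a d) (≤-reflexive (sym (+-suc a d)))))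
            (vert (at-consec (a + d) (subst (_≤ m) (+-suc a d) le)))))
        where
        a+d≤a+1+d : a + d ≤ a + suc d
        a+d≤a+1+d = +-monoʳ-≤ a (n≤1+n d)
        a+d≤m : a + d ≤ m
        a+d≤m = ≤-trans a+d≤a+1+d le

    -- Go from α (hs i) forward around the path back to hs i, using every edge except the i-th.
    closedPath-around : ∀ S′ i → (∀ j → j ≢ i → S′ (hs j) ≡ true) → Conn M S′ (hs i) (α (hs i))
    closedPath-around S′ i others = subst (λ x → Conn M S′ x (α x)) (cong hs (clamp-toℕ m i)) (csym back)
      where
      c = toℕ i
      c≤m : c ≤ m
      c≤m = s≤s⁻¹ (toℕ<n i)
      others′ : ∀ c′ → c′ ≤ m → c′ ≢ c → S′ (at c′) ≡ true
      others′ c′ c′≤m c′≢c =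
        others (clamp m c′) (λ eq → c′≢c (trans (sym (toℕ-clamp m c′ c′≤m)) (cong toℕ eq)))
      from-start : Conn M S′ (at 0) (at c)
      from-start = segment S′ 0 c c≤m (λ c′ _ c′<c → others′ c′ (≤-trans (<⇒≤ c′<c) c≤m) (<⇒≢ c′<c))
      to-end : c < m → Conn M S′ (at (suc c)) (at m)
      to-end c<m = subst (λ k → Conn M S′ (at (suc c)) (at k)) (m+[n∸m]≡n c<m)
        (segment S′ (suc c) (m ∸ suc c) (≤-reflexive (m+[n∸m]≡n c<m))
          (λ c′ c<c′ c′<m → others′ c′ (≤-trans (<⇒≤ c′<m) (≤-reflexive (m+[n∸m]≡n c<m))) (>⇒≢ c<c′)))
      back : Conn M S′ (α (at c)) (at c)
      back with m≤n⇒m<n∨m≡n c≤m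
      ... | inj₂ c≡m = ctrans (vert (subst (λ k → α (at k) ~ at 0) (sym c≡m) at-close)) from-start
      ... | inj₁ c<m = ctrans (vert (at-consec c c<m)) (ctrans (to-end c<m)
                         (ctrans (edge (others′ m ≤-refl (>⇒≢ c<m))) (ctrans (vert at-close) from-start)))

    -- If no other edge of the path is in D, the ends of hs i are joined outside D, so D without hs i
    -- still disconnects, against minimality.
    cocycle-closedPath-meet : ∀ {D} → IsCocycle M D → ∀ i → D (hs i) ≡ true →
      ∃ λ j → j ≢ i × D (hs j) ≡ true
    cocycle-closedPath-meet {D} (D-edges , D-disconnects , D-minimal) i i∈D
      with any? (λ j → ¬? (j ≟ i) ×-dec (D (hs j) ≟ᵇ true))
    ... | yes meet = meet
    ... | no none = ⊥-elim (∖-∌ D (hs i) (D-minimal (D ∖ hs i) (∖-isEdgeSet D-edges (hs i)) (λ _ → ∖-⊆ D)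
                      still-disconnects (hs i) i∈D))
      where
      i-linked : Conn M (complement M D) (hs i) (α (hs i))
      i-linked = closedPath-around (complement M D) i λ j j≢i →
        cong not (¬-not λ j∈D → none (j , j≢i , j∈D))
      still-disconnects : Disconnecting M (D ∖ hs i)
      still-disconnects connected = D-disconnects λ a b → Conn-∖-complement i-linked (connected a b)

    closedPath-balanced : (f : H M → Bool) → (∀ x → f (σf M x) ≡ f x) → ∀ i →
      (∀ j → j ≢ i → f (hs j) ≡ f (α (hs j))) → f (hs i) ≡ f (α (hs i))
    closedPath-balanced f f-σ i others =
      Conn-invariant f f-σ agrees (closedPath-around agree i (λ j j≢i → dec-true (_ ≟ᵇ _) (others j j≢i)))
      where
      agree : EdgeSet M
      agree x = does (f x ≟ᵇ f (α x))
      agrees : ∀ x → agree x ≡ true → f (α x) ≡ f x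
      agrees x = sym ∘ true-witness (f x ≟ᵇ f (α x))

    closedPath-crossing-pair : (f : H M → Bool) → (∀ x → f (σf M x) ≡ f x) → ∀ i →
      f (hs i) ≢ f (α (hs i)) → ∃ λ j → j ≢ i × f (hs j) ≢ f (α (hs j))
    closedPath-crossing-pair f f-σ i i-crosses
      with any? (λ j → ¬? (j ≟ i) ×-dec ¬? (f (hs j) ≟ᵇ f (α (hs j))))
    ... | yes (j , j≢i , j-crosses) = j , j≢i , j-crosses
    ... | no none = ⊥-elim (i-crosses (closedPath-balanced f f-σ i λ j j≢i →
                      decidable-stable (f (hs j) ≟ᵇ f (α (hs j))) (λ j-crosses → none (j , j≢i , j-crosses))))

module TreeCut (M : Map) (T : EdgeSet M) (tree : SpanningTree M T) where
  open Map M
  open MapProperties M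
  open ClosedPaths M

  T-edges : IsEdgeSet M T
  T-edges = proj₁ tree

  T-connected : Connected M T
  T-connected = proj₁ (proj₂ tree)

  closedPath-⊄T : ∀ {m hs} → SimpleClosedPath M m hs → ¬ (∀ i → T (hs i) ≡ true)
  closedPath-⊄T scp hs-∈ = proj₂ (proj₂ tree) _ (edgesOf-isCycle scp) (edgesOf-⊆ T-edges hs-∈)

  ∖-disconnects : ∀ {e} → T e ≡ true → ¬ Conn M (T ∖ e) e (α e)
  ∖-disconnects {e} Te c = closedPath-⊄T simple all-∈
    where
    open CycleThrough (cycleThrough (∖-isEdgeSet T-edges e) (∖-self {T} e) (csym c))
    all-∈ : ∀ i → T (path i) ≡ true
    all-∈ zero    = subst (λ x → T x ≡ true) (sym starts) Te
    all-∈ (suc i) = ∖-⊆ T (rest-∈ i)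

  -- Deleting the internal edge e splits T into the components of e and of α e; side tells which one a
  -- half-edge lies in, and cut is the fundamental cocycle of e.
  module Side (e : H M) (Te : T e ≡ true) where
    private
      Reached : H M → Set
      Reached z = Conn M (T ∖ e) e z ⊎ Conn M (T ∖ e) (α e) z

      extend : ∀ {x y} → Conn M (T ∖ e) x y → Reached x → Reached y
      extend c (inj₁ d) = inj₁ (ctrans d c)
      extend c (inj₂ d) = inj₂ (ctrans d c)

      reached-along : ∀ {x y} → Conn M T x y → (Reached x → Reached y) × (Reached y → Reached x)
      reached-along (vert p) = extend (vert p) , extend (vert (~-sym p))
      reached-along {h} (edge h∈T) with onEdge? e h
      ... | no h∉e = extend (edge (∖-intro T h∈T h∉e)) , extend (csym (edge (∖-intro T h∈T h∉e)))
      ... | yes (inj₁ refl) = (λ _ → inj₂ (vert ~-refl)) , (λ _ → inj₁ (vert ~-refl))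
      ... | yes (inj₂ refl) = (λ _ → inj₁ (vert (≡⇒~ (sym (α-inv e))))) , (λ _ → inj₂ (vert ~-refl))
      reached-along (csym c) = proj₂ (reached-along c) , proj₁ (reached-along c)
      reached-along (ctrans c d) = proj₁ (reached-along d) ∘ proj₁ (reached-along c) ,
                                   proj₂ (reached-along c) ∘ proj₂ (reached-along d)

      reached : ∀ x → Reached x
      reached x = proj₁ (reached-along (T-connected e x)) (inj₁ (vert ~-refl))

    side : H M → Bool
    side x = [ (λ _ → true) , (λ _ → false) ]′ (reached x)

    side-true : ∀ {x} → Conn M (T ∖ e) e x → side x ≡ true
    side-true {x} c with reached x
    ... | inj₁ _ = refl
    ... | inj₂ d = ⊥-elim (∖-disconnects Te (ctrans c (csym d)))

    side-false : ∀ {x} → Conn M (T ∖ e) (α e) x → side x ≡ false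
    side-false {x} c with reached x
    ... | inj₂ _ = refl
    ... | inj₁ d = ⊥-elim (∖-disconnects Te (ctrans d (csym c)))

    side-component : ∀ x →
      (side x ≡ true × Conn M (T ∖ e) e x) ⊎ (side x ≡ false × Conn M (T ∖ e) (α e) x)
    side-component x with reached x
    ... | inj₁ c = inj₁ (refl , c)
    ... | inj₂ c = inj₂ (refl , c)

    side-∖-invariant : ∀ {x y} → Conn M (T ∖ e) x y → side x ≡ side y
    side-∖-invariant {x} c with side-component x
    ... | inj₁ (sx , d) = trans sx (sym (side-true (ctrans d c)))
    ... | inj₂ (sx , d) = trans sx (sym (side-false (ctrans d c)))

    side-σ : ∀ x → side (σf M x) ≡ side x
    side-σ x = sym (side-∖-invariant (vert (~-step x)))

    Crossing : H M → Set
    Crossing x = side x ≢ side (α x)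

    side-e : side e ≡ true
    side-e = side-true (vert ~-refl)

    side-αe : side (α e) ≡ false
    side-αe = side-false (vert ~-refl)

    e-crossing : Crossing e
    e-crossing eq with () ← trans (sym side-e) (trans eq side-αe)

    Crossing-onEdge : ∀ {x y} → OnEdge x y → Crossing x → Crossing y
    Crossing-onEdge (inj₁ refl) cr = cr
    Crossing-onEdge {x} (inj₂ refl) cr eq = cr (sym (trans eq (cong side (α-inv x))))

    ∖-¬crossing : ∀ {x} → (T ∖ e) x ≡ true → ¬ Crossing x
    ∖-¬crossing x∈ = _$ side-∖-invariant (edge x∈)

    crossing-T : ∀ {x} → Crossing x → T x ≡ true → OnEdge e x
    crossing-T {x} cr x∈T with onEdge? e x
    ... | yes x∼e = x∼e
    ... | no  x∉e = ⊥-elim (∖-¬crossing (∖-intro T x∈T x∉e) cr)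

    crossing-connects : ∀ {S′} → IsEdgeSet M S′ → _⊆_ M (T ∖ e) S′ →
      ∀ {x} → S′ x ≡ true → Crossing x → Connected M S′
    crossing-connects {S′} S′-edges ∖⊆S′ {x} x∈S′ cr a b = ctrans (csym (from-e a)) (from-e b)
      where
      lift : ∀ {a b} → Conn M (T ∖ e) a b → Conn M S′ a b
      lift = Conn-mono ∖⊆S′
      across : Conn M S′ e (α e)
      across with side-component x | side-component (α x)
      ... | inj₁ (_ , c) | inj₂ (_ , c′) = ctrans (lift c) (ctrans (edge x∈S′) (csym (lift c′)))
      ... | inj₂ (_ , c) | inj₁ (_ , c′) = ctrans (lift c′) (ctrans (edge (edgeSet-α S′-edges x∈S′))
                                             (subst (λ z → Conn M S′ z (α e)) (sym (α-inv x)) (csym (lift c))))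
      ... | inj₁ (s , _) | inj₁ (s′ , _) = ⊥-elim (cr (trans s (sym s′)))
      ... | inj₂ (s , _) | inj₂ (s′ , _) = ⊥-elim (cr (trans s (sym s′)))
      from-e : ∀ z → Conn M S′ e z
      from-e z with reached z
      ... | inj₁ c = lift c
      ... | inj₂ c = ctrans across (lift c)

    exchange : ∀ {x} → Crossing x → SpanningTree M (swap M T e x)
    exchange {x} cr = swap-isEdgeSet T-edges e x ,
      crossing-connects (swap-isEdgeSet T-edges e x) (λ _ → swap-old T) (swap-new T (inj₁ refl)) cr ,
      acyclic
      where
      -- A cycle of T - e + x either avoids x, and so lies in T, or crosses the cut of e at x alone.
      acyclic : ∀ C → IsCycle M C → ¬ (_⊆_ M C (swap M T e x))
      acyclic C (m , hs , scp , _ , has) C⊆ with any? (λ i → onEdge? x (hs i))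
      ... | no x∉C = closedPath-⊄T scp λ i → case swap-elim T (C⊆ _ (proj₁ (has i))) of λ where
              (inj₁ old) → ∖-⊆ T old
              (inj₂ new) → ⊥-elim (x∉C (i , new))
      ... | yes (i , x∼i)
            with j , j≢i , j-crosses ← closedPath-crossing-pair scp side side-σ i (Crossing-onEdge x∼i cr)
            with swap-elim T (C⊆ _ (proj₁ (has j)))
      ...   | inj₁ old = ∖-¬crossing old j-crosses
      ...   | inj₂ x∼j = j≢i (closedPath-edge-unique scp j i x∼j x∼i)

    cut : EdgeSet M
    cut x = side x xor side (α x)

    cut-isCocycle : IsCocycle M cut
    cut-isCocycle = cut-isEdgeSet , disconnects , minimal
      where
      cut-isEdgeSet : IsEdgeSet M cut
      cut-isEdgeSet x =
        trans (xor-comm (side x) (side (α x))) (cong (λ z → side (α x) xor side z) (sym (α-inv x)))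
      disconnects : Disconnecting M cut
      disconnects connected = e-crossing
        (Conn-invariant side side-σ (λ h h∉cut → sym (xor-≡ (not-injective h∉cut))) (connected e (α e)))
      minimal : ∀ D → IsEdgeSet M D → _⊆_ M D cut → Disconnecting M D → _⊆_ M cut D
      minimal D D-edges D⊆cut D-disconnects h h∈cut with D h in Dh
      ... | true  = refl
      ... | false =
        ⊥-elim (D-disconnects (crossing-connects (cong not ∘ D-edges) ∖⊆∁D (cong not Dh) (xor-≢ h∈cut)))
        where
        ∖⊆∁D : _⊆_ M (T ∖ e) (complement M D)
        ∖⊆∁D z z∈ with D z in Dz
        ... | false = refl
        ... | true  = ⊥-elim (∖-¬crossing z∈ (xor-≢ (D⊆cut z Dz)))

    closedPath-recrossing : ∀ {m hs} → SimpleClosedPath M m hs → ∀ {i} → OnEdge e (hs i) →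
      ∃ λ j → T (hs j) ≡ false × Crossing (hs j)
    closedPath-recrossing {hs = hs} scp {i} e∼i
      with j , j≢i , j-crosses ← closedPath-crossing-pair scp side side-σ i (Crossing-onEdge e∼i e-crossing)
      with T (hs j) in Tj
    ... | true  = ⊥-elim (j≢i (closedPath-edge-unique scp j i (crossing-T j-crosses Tj) e∼i))
    ... | false = j , Tj , j-crosses

  fundamentalCycle : ∀ {e} → T e ≡ false → CycleThrough T e
  fundamentalCycle e∉T = cycleThrough T-edges e∉T (T-connected _ _)

  -- e is the only edge of the cycle outside T, so it is where the cycle crosses the cut of path (suc i) again.
  cycleThrough-exchange : ∀ {e} (C : CycleThrough T e) i →
    SpanningTree M (swap M T (CycleThrough.path C (suc i)) e)
  cycleThrough-exchange {e} C i = exchange (e-crosses (closedPath-recrossing simple {suc i} (inj₁ refl)))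
    where
    open CycleThrough C
    open Side (path (suc i)) (rest-∈ i)
    e-crosses : (∃ λ j → T (path j) ≡ false × Crossing (path j)) → Crossing e
    e-crosses (zero  , _  , cr) = subst Crossing starts cr
    e-crosses (suc j , Tj , _)  with () ← trans (sym Tj) (rest-∈ j)

module TourOrder (M : Map) (T : EdgeSet M) (tree : SpanningTree M T) where
  open Map M
  open MapProperties M
  open TreeCut M T tree

  t : H M → H M
  t = motion M T

  motion-internal : ∀ {x} → T x ≡ true → t x ≡ σf M (α x)
  motion-internal x∈T rewrite x∈T = refl

  motion-external : ∀ {x} → T x ≡ false → t x ≡ σf M x
  motion-external x∉T rewrite x∉T = refl

  motion-injective : ∀ {x y} → t x ≡ t y → x ≡ y
  motion-injective {x} {y} eq with T x in Tx | T y in Ty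
  ... | true  | true  = α-injective (σ-injective eq)
  ... | false | false = σ-injective eq
  ... | true  | false with () ← trans (sym Tx) (trans (T-edges x) (trans (cong T (σ-injective eq)) Ty))
  ... | false | true  with () ← trans (sym Ty) (trans (T-edges y) (trans (cong T (sym (σ-injective eq))) Tx))

  open Orbits t motion-injective using (_↝_; ↝-refl; ↝-trans; ↝-bounded; ↝-exit)

  -- From t h = σ (α h) the tour stays on the side of α h in T - h until it comes back through α h.
  α-reachable : ∀ {h} → T h ≡ true → h ↝ α h
  α-reachable {h} h∈T = ↝-exit (λ z → side z ≡ false) stays
    (trans (cong side (motion-internal h∈T)) (trans (side-σ (α h)) side-αe))
    (λ h-false → case trans (sym side-e) h-false of λ ())
    where
    open Side h h∈T
    stays : ∀ z → side z ≡ false → z ≢ α h → side (t z) ≡ false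
    stays z z-false z≢αh with T z in Tz
    ... | false = trans (side-σ z) z-false
    ... | true  = trans (side-σ (α z)) (trans (sym (side-∖-invariant (edge (∖-intro T Tz z∉h)))) z-false)
      where
      z∉h : ¬ OnEdge h z
      z∉h (inj₁ refl) = case trans (sym side-e) z-false of λ ()
      z∉h (inj₂ z≡αh) = z≢αh z≡αh

  root-reaches : ∀ h → root ↝ h
  root-reaches h = Walk-closed (root ↝_) reaches-~ reaches-α (fromConn T-edges (T-connected root h)) ↝-refl
    where
    open Walks M T
    reaches-α : ∀ {x} → T x ≡ true → root ↝ x → root ↝ α x
    reaches-α x∈T r = ↝-trans r (α-reachable x∈T)
    reaches-σ : ∀ {x} → root ↝ x → root ↝ σf M x
    reaches-σ {x} r with T x in Tx
    ... | false = ↝-trans r (1 , motion-external Tx)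
    ... | true  = ↝-trans (reaches-α Tx r)
                    (1 , trans (motion-internal (edgeSet-α T-edges Tx)) (cong (σf M) (α-inv x)))
    reaches-~ : ∀ {x y} → x ~ y → root ↝ x → root ↝ y
    reaches-~ (zero  , refl) r = r
    reaches-~ (suc k , refl) r = reaches-σ (reaches-~ (k , refl) r)

  iter-pos : ∀ h → iter t (pos M T h) root ≡ h
  iter-pos h with k , k<n , eq ← ↝-bounded (root-reaches h)
             with k′ , pos≡k′ , eq′ ← findPos-correct t n 0 root h (k , k<n , eq) =
    trans (cong (λ j → iter t j root) pos≡k′) eq′

  pos-injective : ∀ {a b} → pos M T a ≡ pos M T b → a ≡ b
  pos-injective {a} {b} eq = trans (sym (iter-pos a)) (trans (cong (λ j → iter t j root) eq) (iter-pos b))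

  ekey-α : ∀ a → ekey M T (α a) ≡ ekey M T a
  ekey-α a = trans (cong (λ z → pos M T (α a) ⊓ pos M T z) (α-inv a)) (⊓-comm (pos M T (α a)) (pos M T a))

  ekey-attained : ∀ a → ∃ λ x → OnEdge a x × ekey M T a ≡ pos M T x
  ekey-attained a with ⊓-sel (pos M T a) (pos M T (α a))
  ... | inj₁ eq = a   , inj₁ refl , eq
  ... | inj₂ eq = α a , inj₂ refl , eq

  ekey-injective : ∀ {a b} → ekey M T a ≡ ekey M T b → OnEdge a b
  ekey-injective {a} {b} eq with x , a∼x , ex ← ekey-attained a | y , b∼y , ey ← ekey-attained b
    rewrite pos-injective {x} {y} (trans (sym ex) (trans eq ey)) = OnEdge-trans a∼x (OnEdge-sym b∼y)

  ekey-onEdge : ∀ {a b} → OnEdge a b → ekey M T b ≡ ekey M T a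
  ekey-onEdge (inj₁ refl) = refl
  ekey-onEdge {a} (inj₂ refl) = ekey-α a

  ekey-antisym : ∀ {a b} → T a ≡ true → T b ≡ false →
    ekey M T a ≤ ekey M T b → ¬ (ekey M T b ≤ ekey M T a)
  ekey-antisym {a} {b} a∈T b∉T a≤b b≤a with () ← trans (sym a∈T)
    (trans (sym (edgeSet-onEdge T-edges (ekey-injective (≤-antisym a≤b b≤a)))) b∉T)

module TreeInterval (M : Map) (T : EdgeSet M) (tree : SpanningTree M T)
                    (S : EdgeSet M) (interval : InTreeInterval M T S) where
  open Map M
  open MapProperties M
  open ClosedPaths M
  open TreeCut M T tree
  open TourOrder M T tree

  S-edges : IsEdgeSet M S
  S-edges = proj₁ interval

  Minimal : EdgeSet M → H M → Set
  Minimal C e = ∀ e′ → C e′ ≡ true → ekey M T e ≤ ekey M T e′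

  MinimalInCycle : H M → Set
  MinimalInCycle e = ∃ λ C → IsCycle M C × _⊆_ M C S × (C e ≡ true) × Minimal C e

  MinimalInCocycle : H M → Set
  MinimalInCocycle e = ∃ λ D → IsCocycle M D × _⊆_ M D (complement M S) × (D e ≡ true) × Minimal D e

  added-active : ∀ {e} → S e ≡ true → T e ≡ false → ∀ e′ → InFundCycle M T e e′ → ekey M T e ≤ ekey M T e′
  added-active e∈S e∉T = proj₁ (proj₂ interval _ λ S≡T → case trans (sym e∈S) (trans S≡T e∉T) of λ ()) e∉T

  removed-active : ∀ {e} → T e ≡ true → S e ≡ false → ∀ e′ → InFundCocycle M T e e′ → ekey M T e ≤ ekey M T e′
  removed-active e∈T e∉S = proj₂ (proj₂ interval _ λ S≡T → case trans (sym e∉S) (trans S≡T e∈T) of λ ()) e∈T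

  exchange-conflict : ∀ {f e} → T f ≡ true → T e ≡ false → SpanningTree M (swap M T f e) →
    S f ≡ false → S e ≡ true → ⊥
  exchange-conflict f∈T e∉T exchanged f∉S e∈S =
    ekey-antisym f∈T e∉T (removed-active f∈T f∉S _ exchanged) (added-active e∈S e∉T _ exchanged)

  edgesOf-minimal : ∀ {m hs e} → (∀ i → ekey M T e ≤ ekey M T (hs i)) → Minimal (edgesOf m hs) e
  edgesOf-minimal below e′ e′∈ with i , hs∼e′ ← edgesOf-sound e′ e′∈ =
    ≤-trans (below i) (≤-reflexive (sym (ekey-onEdge hs∼e′)))

  added⇒minimal-in-cycle : ∀ {e} → S e ≡ true → T e ≡ false → MinimalInCycle e
  added⇒minimal-in-cycle {e} e∈S e∉T =
    edgesOf len path , edgesOf-isCycle simple , edgesOf-⊆ S-edges path-∈S ,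
    edgesOf-complete {hs = path} zero (inj₁ (sym starts)) , edgesOf-minimal below
    where
    open CycleThrough (fundamentalCycle e∉T)
    path-∈S : ∀ i → S (path i) ≡ true
    path-∈S zero    = subst (λ x → S x ≡ true) (sym starts) e∈S
    path-∈S (suc i) with S (path (suc i)) in Si
    ... | true  = refl
    ... | false = ⊥-elim (exchange-conflict (rest-∈ i) e∉T (cycleThrough-exchange (fundamentalCycle e∉T) i) Si e∈S)
    below : ∀ i → ekey M T e ≤ ekey M T (path i)
    below zero    = ≤-reflexive (cong (ekey M T) (sym starts))
    below (suc i) = added-active e∈S e∉T _ (cycleThrough-exchange (fundamentalCycle e∉T) i)

  minimal-in-cycle⇒added : ∀ {e} → MinimalInCycle e → S e ≡ true × T e ≡ false
  minimal-in-cycle⇒added {e} (C , (m , hs , scp , sound , has) , C⊆S , e∈C , minimal) =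
    C⊆S e e∈C , ¬-not not-internal
    where
    not-internal : T e ≡ true → ⊥
    not-internal e∈T = added-recrossing (closedPath-recrossing scp (OnEdge-sym (proj₂ (sound e e∈C))))
      where
      open Side e e∈T
      added-recrossing : (∃ λ j → T (hs j) ≡ false × Crossing (hs j)) → ⊥
      added-recrossing (j , Tj , j-crosses) = ekey-antisym e∈T Tj (minimal (hs j) (proj₁ (has j)))
        (added-active (C⊆S _ (proj₁ (has j))) Tj e (exchange j-crosses))

  removed⇒minimal-in-cocycle : ∀ {e} → T e ≡ true → S e ≡ false → MinimalInCocycle e
  removed⇒minimal-in-cocycle {e} e∈T e∉S = cut , cut-isCocycle , cut-⊆∁S , ≢-xor e-crossing ,
    λ e′ e′∈cut → removed-active e∈T e∉S e′ (exchange (xor-≢ e′∈cut))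
    where
    open Side e e∈T
    cut-⊆∁S : _⊆_ M cut (complement M S)
    cut-⊆∁S x x∈cut with S x in Sx
    ... | false = refl
    ... | true with T x in Tx
    ...   | true  with () ← trans (sym Sx) (trans (edgeSet-onEdge S-edges (crossing-T (xor-≢ x∈cut) Tx)) e∉S)
    ...   | false = ⊥-elim (exchange-conflict e∈T Tx (exchange (xor-≢ x∈cut)) e∉S Sx)

  minimal-in-cocycle⇒removed : ∀ {e} → MinimalInCocycle e → T e ≡ true × S e ≡ false
  minimal-in-cocycle⇒removed {e} (D , D-cocycle , D⊆∁S , e∈D , minimal) =
    ¬-not (λ e∉T → not-external e∉T (fundamentalCycle e∉T)) , not-injective (D⊆∁S e e∈D)
    where
    not-external : T e ≡ false → CycleThrough T e → ⊥
    not-external e∉T C =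
      second-meet (cocycle-closedPath-meet simple D-cocycle zero (subst (λ x → D x ≡ true) (sym starts) e∈D))
      where
      open CycleThrough C
      second-meet : (∃ λ j → j ≢ zero × D (path j) ≡ true) → ⊥
      second-meet (zero  , 0≢0 , _)  = 0≢0 refl
      second-meet (suc j , _   , Dj) = ekey-antisym (rest-∈ j) e∉T
        (removed-active (rest-∈ j) (not-injective (D⊆∁S _ Dj)) e (cycleThrough-exchange C j)) (minimal _ Dj)

lemma17 : (M : Map) → Transitive M →
  (T : EdgeSet M) → SpanningTree M T →
  (S : EdgeSet M) → InTreeInterval M T S →
  (e : H M) →
    (((S e ≡ true) × (T e ≡ false)) ⇔
      (∃ λ C → IsCycle M C × _⊆_ M C S × (C e ≡ true) ×
        (∀ e' → C e' ≡ true → ekey M T e ≤ ekey M T e')))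
    ×
    (((T e ≡ true) × (S e ≡ false)) ⇔
      (∃ λ D → IsCocycle M D × _⊆_ M D (complement M S) × (D e ≡ true) ×
        (∀ e' → D e' ≡ true → ekey M T e ≤ ekey M T e')))
lemma17 M _ T tree S interval e =
  mk⇔ (λ (e∈S , e∉T) → added⇒minimal-in-cycle e∈S e∉T) minimal-in-cycle⇒added ,
  mk⇔ (λ (e∈T , e∉S) → removed⇒minimal-in-cocycle e∈T e∉S) minimal-in-cocycle⇒removed
  where open TreeInterval M T tree S interval
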